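{- Let $Q_k$ be the hypercube on $2^k$ vertices. For each graph $G$ there is a bivariate polynomial $p(G;x_1,x_2)$ such that $\mathrm{hom}(G,Q_k)=p(G;k,2^k)$ for all $k\ge0$.
   Context: $Q_k$ has vertex set $\mathbb{Z}_2^k$, two vertices adjacent iff they differ in exactly one coordinate ($Q_0=K_1$). $\mathrm{hom}(G,H)$ is the number of homomorphisms from the finite graph $G$ to $H$. -}

module Defs where

open import Data.Bool using (Bool; true; false; _∧_; if_then_else_)
open import Data.Nat using (ℕ; zero; suc; _+_; _≡ᵇ_)
open import Data.Fin using (Fin)
open import Data.Vec using (Vec; []; _∷_; lookup)
open import Data.List using (List; []; _∷_; [_]; concatMap; map; length; filterᵇ; foldr)
open import Data.Product using (_×_; _,_)
open import Data.Rational using (ℚ; 0ℚ; 1ℚ) renaming (_+_ to _+ℚ_; _*_ to _*ℚ_)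
import Data.Rational as ℚ

-- A finite graph: n vertices Fin n and a list of edges (pairs of vertices).
-- (Loops / repeated edges are allowed; this only makes the statement more general.)
record Graph : Set where
  field
    n     : ℕ
    edges : List (Fin n × Fin n)
open Graph public

-- Vertices of Q_k: vectors in Z_2^k, represented as Vec Bool k.
-- Hamming distance.
hamming : ∀ {k} → Vec Bool k → Vec Bool k → ℕ
hamming [] [] = 0
hamming (x ∷ xs) (y ∷ ys) = (if eqB x y then 0 else 1) + hamming xs ys
  where
  eqB : Bool → Bool → Bool
  eqB true true = true
  eqB false false = true
  eqB _ _ = false

adjQ : ∀ {k} → Vec Bool k → Vec Bool k → Bool
adjQ u v = hamming u v ≡ᵇ 1

vecsOver : ∀ {A : Set} → List A → (m : ℕ) → List (Vec A m)
vecsOver xs zero = [ [] ]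
vecsOver xs (suc m) = concatMap (λ x → map (x ∷_) (vecsOver xs m)) xs

vertsQ : (k : ℕ) → List (Vec Bool k)
vertsQ k = vecsOver (true ∷ false ∷ []) k

allB : ∀ {A : Set} → (A → Bool) → List A → Bool
allB p [] = true
allB p (x ∷ xs) = p x ∧ allB p xs

isHom : (G : Graph) {k : ℕ} → Vec (Vec Bool k) (n G) → Bool
isHom G f = allB (λ { (u , v) → adjQ (lookup f u) (lookup f v) }) (edges G)

homQ : Graph → ℕ → ℕ
homQ G k = length (filterᵇ (isHom G) (vecsOver (vertsQ k) (n G)))

-- Bivariate polynomials over ℚ: finite lists of monomials (i , j , c) = c·x₁^i·x₂^j.
Poly₂ : Set
Poly₂ = List (ℕ × ℕ × ℚ)

powℚ : ℚ → ℕ → ℚ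
powℚ x zero = 1ℚ
powℚ x (suc m) = x *ℚ powℚ x m

eval₂ : Poly₂ → ℚ → ℚ → ℚ
eval₂ p x₁ x₂ = foldr (λ { (i , j , c) acc → (c *ℚ powℚ x₁ i *ℚ powℚ x₂ j) +ℚ acc }) 0ℚ p

toℚ : ℕ → ℚ
toℚ m = ℚ._/_ (Data.Integer.+ m) 1
  where import Data.Integer

-- Write a map V(G) → V(Q_k) as k columns b ∈ Z₂^V and count maps by the list t of
-- Hamming lengths of the edges, N_k(t).  Splitting off one column gives
--   N_{k+1}(t) = A · N_k(t) + Σ_{b cutting some edge} N_k(t − cut b),
-- where A counts the columns that are constant along every edge.  These form a subgroup
-- of Z₂^V, so A = 2^c.  The second sum involves only smaller t, so by induction on the
-- sum of t every N_k(t) has the form A^k q(k) with q a polynomial: the recurrence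
-- g(k+1) = A g(k) + A^k p(k) is solved by q(k) = g(0) + Σ_{i<k} p(i)/A, and the
-- falling-factorial basis makes that antidifference explicit.  Finally
-- hom(G, Q_k) = N_k(1, …, 1) and A^k = (2^k)^c.
module Submission where

open import Defs
open import Data.Fin using (Fin)
open import Data.List using (List)
open import Data.Nat using (ℕ; _^_)
open import Data.Product using (∃; _×_)
open import Relation.Binary.PropositionalEquality using (_≡_)

module NatEmbedding where
  open import Data.Nat using (zero; suc; NonZero)
  import Data.Nat as ℕ
  open import Data.Nat.Coprimality using (Coprime; 1-coprimeTo) renaming (sym to coprime-sym)
  open import Data.Integer using (+_)
  import Data.Integer as ℤ
  import Data.Integer.Properties as ℤ
  open import Data.Rational using (ℚ; mkℚ; 0ℚ; 1ℚ; _+_; _*_; 1/_; toℚᵘ)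
  import Data.Rational.Properties as ℚ
  open import Data.Rational.Unnormalised using (mkℚᵘ)
  import Data.Rational.Unnormalised as ℚᵘ
  import Data.Rational.Unnormalised.Properties as ℚᵘ
  open import Data.Product using (_,_)
  open import Relation.Binary.PropositionalEquality

  -- An opaque copy of toℚ: conversion checking then compares the ℕ arguments instead of
  -- unfolding the gcd normalisation inside toℚ, which is prohibitively expensive.
  opaque
    fromℕ : ℕ → ℚ
    fromℕ = toℚ

    fromℕ≡toℚ : ∀ m → fromℕ m ≡ toℚ m
    fromℕ≡toℚ m = refl

    fromℕ-0 : fromℕ 0 ≡ 0ℚ
    fromℕ-0 = refl

    fromℕ-1 : fromℕ 1 ≡ 1ℚ
    fromℕ-1 = refl

    toℚᵘ-fromℕ : ∀ m → toℚᵘ (fromℕ m) ℚᵘ.≃ mkℚᵘ (+ m) 0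
    toℚᵘ-fromℕ m = ℚ.toℚᵘ-fromℚᵘ _

    fromℕ-+ : ∀ m n → fromℕ (m ℕ.+ n) ≡ fromℕ m + fromℕ n
    fromℕ-+ m n = ℚ.toℚᵘ-injective (begin
      toℚᵘ (fromℕ (m ℕ.+ n))               ≈⟨ toℚᵘ-fromℕ (m ℕ.+ n) ⟩
      mkℚᵘ (+ (m ℕ.+ n)) 0                 ≡⟨ cong (λ z → mkℚᵘ z 0) (ℤ.pos-+ m n) ⟩
      mkℚᵘ (+ m ℤ.+ + n) 0                 ≡⟨ cong (λ z → mkℚᵘ z 0)
                                                (cong₂ ℤ._+_ (ℤ.*-identityʳ (+ m)) (ℤ.*-identityʳ (+ n))) ⟨
      mkℚᵘ (+ m) 0 ℚᵘ.+ mkℚᵘ (+ n) 0       ≈⟨ ℚᵘ.+-cong (toℚᵘ-fromℕ m) (toℚᵘ-fromℕ n) ⟨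
      toℚᵘ (fromℕ m) ℚᵘ.+ toℚᵘ (fromℕ n)   ≈⟨ ℚ.toℚᵘ-homo-+ (fromℕ m) (fromℕ n) ⟨
      toℚᵘ (fromℕ m + fromℕ n)             ∎)
      where open ℚᵘ.≃-Reasoning

    fromℕ-* : ∀ m n → fromℕ (m ℕ.* n) ≡ fromℕ m * fromℕ n
    fromℕ-* m n = ℚ.toℚᵘ-injective (begin
      toℚᵘ (fromℕ (m ℕ.* n))               ≈⟨ toℚᵘ-fromℕ (m ℕ.* n) ⟩
      mkℚᵘ (+ (m ℕ.* n)) 0                 ≡⟨ cong (λ z → mkℚᵘ z 0) (ℤ.pos-* m n) ⟩
      mkℚᵘ (+ m) 0 ℚᵘ.* mkℚᵘ (+ n) 0       ≈⟨ ℚᵘ.*-cong (toℚᵘ-fromℕ m) (toℚᵘ-fromℕ n) ⟨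
      toℚᵘ (fromℕ m) ℚᵘ.* toℚᵘ (fromℕ n)   ≈⟨ ℚ.toℚᵘ-homo-* (fromℕ m) (fromℕ n) ⟨
      toℚᵘ (fromℕ m * fromℕ n)             ∎)
      where open ℚᵘ.≃-Reasoning

    fromℕ-invertible : ∀ m .{{_ : NonZero m}} → ∃ λ i → i * fromℕ m ≡ 1ℚ
    fromℕ-invertible (suc m) = 1/ q , trans (cong (1/ q *_) (ℚ.normalize-coprime coprime)) (ℚ.*-inverseˡ q)
      where
      coprime : Coprime (suc m) 1
      coprime = coprime-sym (1-coprimeTo (suc m))
      q : ℚ
      q = mkℚ (+ suc m) 0 coprime

  fromℕ-suc : ∀ m → fromℕ (suc m) ≡ 1ℚ + fromℕ m
  fromℕ-suc m = trans (fromℕ-+ 1 m) (cong (_+ fromℕ m) fromℕ-1)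

  fromℕ-^ : ∀ m k → fromℕ (m ^ k) ≡ powℚ (fromℕ m) k
  fromℕ-^ m zero = fromℕ-1
  fromℕ-^ m (suc k) = trans (fromℕ-* m (m ^ k)) (cong (fromℕ m *_) (fromℕ-^ m k))

module ExponentialPolynomials where
  open NatEmbedding
  open import Data.Nat using (zero; suc)
  open import Data.List using (List; []; _∷_; _++_; map)
  open import Data.Product using (_×_; _,_)
  open import Data.Rational using (ℚ; 0ℚ; 1ℚ; _+_; _*_; _-_)
  import Data.Rational.Properties as ℚ
  open import Data.Rational.Solver using (module +-*-Solver)
  open +-*-Solver
  open import Relation.Binary.PropositionalEquality

  fallingFactorial : ℚ → ℕ → ℚ
  fallingFactorial x zero = 1ℚ
  fallingFactorial x (suc j) = fallingFactorial x j * (x - fromℕ j)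

  fallingFactorial-Δ : ∀ x j →
    fallingFactorial (1ℚ + x) (suc j) ≡ fallingFactorial x (suc j) + fromℕ (suc j) * fallingFactorial x j
  fallingFactorial-Δ x zero rewrite fromℕ-0 | fromℕ-1 =
    solve 1 (λ x → con 1ℚ :* (con 1ℚ :+ x :- con 0ℚ) := con 1ℚ :* (x :- con 0ℚ) :+ con 1ℚ :* con 1ℚ) refl x
  fallingFactorial-Δ x (suc j) rewrite fallingFactorial-Δ x j | fromℕ-suc (suc j) | fromℕ-suc j =
    solve 3 (λ F x t → (F :* (x :- t) :+ (con 1ℚ :+ t) :* F) :* (con 1ℚ :+ x :- (con 1ℚ :+ t))
                     := F :* (x :- t) :* (x :- (con 1ℚ :+ t)) :+ (con 1ℚ :+ (con 1ℚ :+ t)) :* (F :* (x :- t)))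
      refl (fallingFactorial x j) x (fromℕ j)

  fallingFactorial-0 : ∀ j → fallingFactorial 0ℚ (suc j) ≡ 0ℚ
  fallingFactorial-0 zero rewrite fromℕ-0 = refl
  fallingFactorial-0 (suc j) rewrite fallingFactorial-0 j = ℚ.*-zeroˡ (0ℚ - fromℕ (suc j))

  -- (b , j) stands for the term b · x(x − 1)⋯(x − j + 1).
  NewtonSeries : Set
  NewtonSeries = List (ℚ × ℕ)

  evalNewton : NewtonSeries → ℚ → ℚ
  evalNewton [] x = 0ℚ
  evalNewton ((b , j) ∷ β) x = b * fallingFactorial x j + evalNewton β x

  evalNewton-++ : ∀ β γ x → evalNewton (β ++ γ) x ≡ evalNewton β x + evalNewton γ x
  evalNewton-++ [] γ x = sym (ℚ.+-identityˡ _)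
  evalNewton-++ ((b , j) ∷ β) γ x rewrite evalNewton-++ β γ x =
    sym (ℚ.+-assoc (b * fallingFactorial x j) (evalNewton β x) (evalNewton γ x))

  scaleNewton : ℚ → NewtonSeries → NewtonSeries
  scaleNewton c = map λ { (b , j) → (c * b , j) }

  evalNewton-scale : ∀ c β x → evalNewton (scaleNewton c β) x ≡ c * evalNewton β x
  evalNewton-scale c [] x = sym (ℚ.*-zeroʳ c)
  evalNewton-scale c ((b , j) ∷ β) x rewrite evalNewton-scale c β x =
    solve 4 (λ c b F E → c :* b :* F :+ c :* E := c :* (b :* F :+ E)) refl
      c b (fallingFactorial x j) (evalNewton β x)

  -- Termwise, using Δ x^(j+1) = (j + 1) x^(j).
  antidifference : ∀ β → ∃ λ γ →
    (∀ x → evalNewton γ (1ℚ + x) ≡ evalNewton γ x + evalNewton β x) × evalNewton γ 0ℚ ≡ 0ℚ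
  antidifference [] = [] , (λ x → sym (ℚ.+-identityˡ 0ℚ)) , refl
  antidifference ((b , j) ∷ β) with fromℕ-invertible (suc j) | antidifference β
  ... | i , i*t≡1 | γ , Δγ≡β , γ0≡0 = (b * i , suc j) ∷ γ , Δ≡ , at0
    where
    Δ≡ : ∀ x → evalNewton ((b * i , suc j) ∷ γ) (1ℚ + x)
             ≡ evalNewton ((b * i , suc j) ∷ γ) x + evalNewton ((b , j) ∷ β) x
    Δ≡ x = begin
      b * i * fallingFactorial (1ℚ + x) (suc j) + evalNewton γ (1ℚ + x)
        ≡⟨ cong₂ _+_ (cong (b * i *_) (fallingFactorial-Δ x j)) (Δγ≡β x) ⟩
      b * i * (F₁ + t * F₀) + (G + B)
        ≡⟨ solve 7 (λ b i t F₁ F₀ G B → b :* i :* (F₁ :+ t :* F₀) :+ (G :+ B)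
                      := b :* i :* F₁ :+ G :+ (b :* F₀ :* (i :* t) :+ B)) refl b i t F₁ F₀ G B ⟩
      b * i * F₁ + G + (b * F₀ * (i * t) + B)
        ≡⟨ cong (λ u → b * i * F₁ + G + (b * F₀ * u + B)) i*t≡1 ⟩
      b * i * F₁ + G + (b * F₀ * 1ℚ + B)
        ≡⟨ cong (λ u → b * i * F₁ + G + (u + B)) (ℚ.*-identityʳ (b * F₀)) ⟩
      b * i * F₁ + G + (b * F₀ + B) ∎
      where
      open ≡-Reasoning
      t F₀ F₁ G B : ℚ
      t = fromℕ (suc j)
      F₀ = fallingFactorial x j
      F₁ = fallingFactorial x (suc j)
      G = evalNewton γ x
      B = evalNewton β x
    at0 : b * i * fallingFactorial 0ℚ (suc j) + evalNewton γ 0ℚ ≡ 0ℚ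
    at0 rewrite fallingFactorial-0 j | γ0≡0 = trans (ℚ.+-identityʳ (b * i * 0ℚ)) (ℚ.*-zeroʳ (b * i))

  ExpPolynomial : ℚ → (ℕ → ℚ) → Set
  ExpPolynomial a g = ∃ λ β → ∀ k → g k ≡ powℚ a k * evalNewton β (fromℕ k)

  ExpPolynomial-cong : ∀ {a f g} → (∀ k → f k ≡ g k) → ExpPolynomial a f → ExpPolynomial a g
  ExpPolynomial-cong f≗g (β , f≡) = β , λ k → trans (sym (f≗g k)) (f≡ k)

  ExpPolynomial-0 : ∀ a → ExpPolynomial a (λ _ → 0ℚ)
  ExpPolynomial-0 a = [] , λ k → sym (ℚ.*-zeroʳ (powℚ a k))

  ExpPolynomial-+ : ∀ {a f g} → ExpPolynomial a f → ExpPolynomial a g → ExpPolynomial a (λ k → f k + g k)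
  ExpPolynomial-+ {a} {f} {g} (β , f≡) (γ , g≡) = β ++ γ , λ k → begin
    f k + g k                            ≡⟨ cong₂ _+_ (f≡ k) (g≡ k) ⟩
    powℚ a k * B k + powℚ a k * Γ k      ≡⟨ ℚ.*-distribˡ-+ (powℚ a k) (B k) (Γ k) ⟨
    powℚ a k * (B k + Γ k)               ≡⟨ cong (powℚ a k *_) (evalNewton-++ β γ (fromℕ k)) ⟨
    powℚ a k * evalNewton (β ++ γ) (fromℕ k) ∎
    where
    open ≡-Reasoning
    B Γ : ℕ → ℚ
    B k = evalNewton β (fromℕ k)
    Γ k = evalNewton γ (fromℕ k)

  -- The solution is g k = a^k (g 0 + Γ k), with Γ the antidifference of a⁻¹ β vanishing at 0.
  ExpPolynomial-recurrence : ∀ {a g h} → (∃ λ a⁻¹ → a⁻¹ * a ≡ 1ℚ) → ExpPolynomial a h →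
    (∀ k → g (suc k) ≡ a * g k + h k) → ExpPolynomial a g
  ExpPolynomial-recurrence {a} {g} {h} (a⁻¹ , a⁻¹*a≡1) (β , h≡) g-step
    with antidifference (scaleNewton a⁻¹ β)
  ... | γ , Δγ , γ0≡0 = (g 0 , 0) ∷ γ , g≡
    where
    open ≡-Reasoning
    g≡ : ∀ k → g k ≡ powℚ a k * (g 0 * 1ℚ + evalNewton γ (fromℕ k))
    g≡ zero rewrite fromℕ-0 | γ0≡0 = solve 1 (λ G → G := con 1ℚ :* (G :* con 1ℚ :+ con 0ℚ)) refl (g 0)
    g≡ (suc k) = begin
      g (suc k)                                 ≡⟨ g-step k ⟩
      a * g k + h k                             ≡⟨ cong₂ (λ u v → a * u + v) (g≡ k) (h≡ k) ⟩
      a * (A * (G₀ + Γ)) + A * B                ≡⟨ cong (a * (A * (G₀ + Γ)) +_) (ℚ.*-identityˡ (A * B)) ⟨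
      a * (A * (G₀ + Γ)) + 1ℚ * (A * B)         ≡⟨ cong (λ u → a * (A * (G₀ + Γ)) + u * (A * B)) a⁻¹*a≡1 ⟨
      a * (A * (G₀ + Γ)) + a⁻¹ * a * (A * B)    ≡⟨ solve 6 (λ a a⁻¹ A B G₀ Γ →
                                                       a :* (A :* (G₀ :+ Γ)) :+ a⁻¹ :* a :* (A :* B)
                                                    := a :* A :* (G₀ :+ (Γ :+ a⁻¹ :* B))) refl a a⁻¹ A B G₀ Γ ⟩
      a * A * (G₀ + (Γ + a⁻¹ * B))              ≡⟨ cong (λ u → a * A * (G₀ + (Γ + u)))
                                                     (evalNewton-scale a⁻¹ β (fromℕ k)) ⟨
      a * A * (G₀ + (Γ + evalNewton (scaleNewton a⁻¹ β) (fromℕ k)))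
                                                ≡⟨ cong (λ u → a * A * (G₀ + u)) (Δγ (fromℕ k)) ⟨
      a * A * (G₀ + evalNewton γ (1ℚ + fromℕ k))  ≡⟨ cong (λ u → a * A * (G₀ + evalNewton γ u)) (fromℕ-suc k) ⟨
      a * A * (G₀ + evalNewton γ (fromℕ (suc k))) ∎
      where
      A B G₀ Γ : ℚ
      A = powℚ a k
      B = evalNewton β (fromℕ k)
      G₀ = g 0 * 1ℚ
      Γ = evalNewton γ (fromℕ k)

module BivariatePolynomials where
  open NatEmbedding
  open ExponentialPolynomials
  open import Data.Nat using (zero; suc)
  import Data.Nat as ℕ
  import Data.Nat.Properties as ℕ
  open import Data.List using ([]; _∷_; _++_; map)
  open import Data.Product using (_×_; _,_)
  open import Data.Rational using (ℚ; 0ℚ; 1ℚ; _+_; _*_; _-_; -_)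
  import Data.Rational.Properties as ℚ
  open import Data.Rational.Solver using (module +-*-Solver)
  open +-*-Solver
  open import Relation.Binary.PropositionalEquality

  eval₂-++ : ∀ p q x y → eval₂ (p ++ q) x y ≡ eval₂ p x y + eval₂ q x y
  eval₂-++ [] q x y = sym (ℚ.+-identityˡ (eval₂ q x y))
  eval₂-++ ((i , j , c) ∷ p) q x y = trans (cong (c * powℚ x i * powℚ y j +_) (eval₂-++ p q x y))
    (sym (ℚ.+-assoc (c * powℚ x i * powℚ y j) (eval₂ p x y) (eval₂ q x y)))

  powℚ-+ : ∀ x i i′ → powℚ x (i ℕ.+ i′) ≡ powℚ x i * powℚ x i′
  powℚ-+ x zero i′ = sym (ℚ.*-identityˡ (powℚ x i′))
  powℚ-+ x (suc i) i′ rewrite powℚ-+ x i i′ = sym (ℚ.*-assoc x (powℚ x i) (powℚ x i′))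

  mulMonomial : ℕ × ℕ × ℚ → Poly₂ → Poly₂
  mulMonomial (i , j , c) = map λ { (i′ , j′ , c′) → (i ℕ.+ i′ , j ℕ.+ j′ , c * c′) }

  eval₂-mulMonomial : ∀ i j c p x y →
    eval₂ (mulMonomial (i , j , c) p) x y ≡ c * powℚ x i * powℚ y j * eval₂ p x y
  eval₂-mulMonomial i j c [] x y = sym (ℚ.*-zeroʳ (c * powℚ x i * powℚ y j))
  eval₂-mulMonomial i j c ((i′ , j′ , c′) ∷ p) x y = begin
    c * c′ * powℚ x (i ℕ.+ i′) * powℚ y (j ℕ.+ j′) + eval₂ (mulMonomial (i , j , c) p) x y
      ≡⟨ cong₂ (λ u v → c * c′ * u * v + eval₂ (mulMonomial (i , j , c) p) x y)
               (powℚ-+ x i i′) (powℚ-+ y j j′) ⟩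
    c * c′ * (a * a′) * (b * b′) + eval₂ (mulMonomial (i , j , c) p) x y
      ≡⟨ cong (c * c′ * (a * a′) * (b * b′) +_) (eval₂-mulMonomial i j c p x y) ⟩
    c * c′ * (a * a′) * (b * b′) + c * a * b * eval₂ p x y
      ≡⟨ solve 7 (λ c c′ a a′ b b′ R → c :* c′ :* (a :* a′) :* (b :* b′) :+ c :* a :* b :* R
                    := c :* a :* b :* (c′ :* a′ :* b′ :+ R)) refl c c′ a a′ b b′ (eval₂ p x y) ⟩
    c * a * b * (c′ * a′ * b′ + eval₂ p x y) ∎
    where
    open ≡-Reasoning
    a a′ b b′ : ℚ
    a = powℚ x i
    a′ = powℚ x i′
    b = powℚ y j
    b′ = powℚ y j′

  fallingFactorialPoly : ℕ → Poly₂
  fallingFactorialPoly zero = (0 , 0 , 1ℚ) ∷ []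
  fallingFactorialPoly (suc j) =
    mulMonomial (1 , 0 , 1ℚ) (fallingFactorialPoly j) ++ mulMonomial (0 , 0 , - fromℕ j) (fallingFactorialPoly j)

  eval₂-fallingFactorialPoly : ∀ j x y → eval₂ (fallingFactorialPoly j) x y ≡ fallingFactorial x j
  eval₂-fallingFactorialPoly zero x y = solve 0 (con 1ℚ :* con 1ℚ :* con 1ℚ :+ con 0ℚ := con 1ℚ) refl
  eval₂-fallingFactorialPoly (suc j) x y = begin
    eval₂ (mulMonomial (1 , 0 , 1ℚ) P ++ mulMonomial (0 , 0 , - fromℕ j) P) x y
      ≡⟨ eval₂-++ (mulMonomial (1 , 0 , 1ℚ) P) (mulMonomial (0 , 0 , - fromℕ j) P) x y ⟩
    eval₂ (mulMonomial (1 , 0 , 1ℚ) P) x y + eval₂ (mulMonomial (0 , 0 , - fromℕ j) P) x y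
      ≡⟨ cong₂ _+_ (eval₂-mulMonomial 1 0 1ℚ P x y) (eval₂-mulMonomial 0 0 (- fromℕ j) P x y) ⟩
    1ℚ * (x * 1ℚ) * 1ℚ * eval₂ P x y + - fromℕ j * 1ℚ * 1ℚ * eval₂ P x y
      ≡⟨ solve 3 (λ x t E → con 1ℚ :* (x :* con 1ℚ) :* con 1ℚ :* E :+ :- t :* con 1ℚ :* con 1ℚ :* E
                           := E :* (x :- t)) refl x (fromℕ j) (eval₂ P x y) ⟩
    eval₂ P x y * (x - fromℕ j)
      ≡⟨ cong (_* (x - fromℕ j)) (eval₂-fallingFactorialPoly j x y) ⟩
    fallingFactorial x (suc j) ∎
    where
    open ≡-Reasoning
    P : Poly₂
    P = fallingFactorialPoly j

  newtonPoly : NewtonSeries → Poly₂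
  newtonPoly [] = []
  newtonPoly ((b , j) ∷ β) = mulMonomial (0 , 0 , b) (fallingFactorialPoly j) ++ newtonPoly β

  eval₂-newtonPoly : ∀ β x y → eval₂ (newtonPoly β) x y ≡ evalNewton β x
  eval₂-newtonPoly [] x y = refl
  eval₂-newtonPoly ((b , j) ∷ β) x y = begin
    eval₂ (mulMonomial (0 , 0 , b) P ++ newtonPoly β) x y
      ≡⟨ eval₂-++ (mulMonomial (0 , 0 , b) P) (newtonPoly β) x y ⟩
    eval₂ (mulMonomial (0 , 0 , b) P) x y + eval₂ (newtonPoly β) x y
      ≡⟨ cong₂ _+_ (eval₂-mulMonomial 0 0 b P x y) (eval₂-newtonPoly β x y) ⟩
    b * 1ℚ * 1ℚ * eval₂ P x y + evalNewton β x
      ≡⟨ cong (_+ evalNewton β x) (solve 2 (λ b E → b :* con 1ℚ :* con 1ℚ :* E := b :* E) refl b (eval₂ P x y)) ⟩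
    b * eval₂ P x y + evalNewton β x
      ≡⟨ cong (λ F → b * F + evalNewton β x) (eval₂-fallingFactorialPoly j x y) ⟩
    b * fallingFactorial x j + evalNewton β x ∎
    where
    open ≡-Reasoning
    P : Poly₂
    P = fallingFactorialPoly j

  powℚ-2^-comm : ∀ c k → powℚ (fromℕ (2 ^ c)) k ≡ powℚ (fromℕ (2 ^ k)) c
  powℚ-2^-comm c k = begin
    powℚ (fromℕ (2 ^ c)) k  ≡⟨ fromℕ-^ (2 ^ c) k ⟨
    fromℕ ((2 ^ c) ^ k)     ≡⟨ cong fromℕ (ℕ.^-*-assoc 2 c k) ⟩
    fromℕ (2 ^ (c ℕ.* k))   ≡⟨ cong (λ e → fromℕ (2 ^ e)) (ℕ.*-comm c k) ⟩
    fromℕ (2 ^ (k ℕ.* c))   ≡⟨ cong fromℕ (ℕ.^-*-assoc 2 k c) ⟨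
    fromℕ ((2 ^ k) ^ c)     ≡⟨ fromℕ-^ (2 ^ k) c ⟩
    powℚ (fromℕ (2 ^ k)) c  ∎
    where open ≡-Reasoning

  ExpPolynomial-2^⇒Poly₂ : ∀ {c g} → ExpPolynomial (fromℕ (2 ^ c)) g →
    ∃ λ p → ∀ k → g k ≡ eval₂ p (toℚ k) (toℚ (2 ^ k))
  ExpPolynomial-2^⇒Poly₂ {c} {g} (β , g≡) = p , g≡p
    where
    p : Poly₂
    p = mulMonomial (0 , c , 1ℚ) (newtonPoly β)

    g≡p : ∀ k → g k ≡ eval₂ p (toℚ k) (toℚ (2 ^ k))
    g≡p k = begin
      g k                                           ≡⟨ g≡ k ⟩
      powℚ (fromℕ (2 ^ c)) k * evalNewton β x       ≡⟨ cong₂ _*_ (powℚ-2^-comm c k)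
                                                                   (sym (eval₂-newtonPoly β x y)) ⟩
      powℚ y c * eval₂ (newtonPoly β) x y           ≡⟨ cong (_* eval₂ (newtonPoly β) x y)
                                                         (solve 1 (λ y → y := con 1ℚ :* con 1ℚ :* y) refl (powℚ y c)) ⟩
      1ℚ * 1ℚ * powℚ y c * eval₂ (newtonPoly β) x y ≡⟨ eval₂-mulMonomial 0 c 1ℚ (newtonPoly β) x y ⟨
      eval₂ p x y                                   ≡⟨ cong₂ (eval₂ p) (fromℕ≡toℚ k) (fromℕ≡toℚ (2 ^ k)) ⟩
      eval₂ p (toℚ k) (toℚ (2 ^ k))                 ∎
      where
      open ≡-Reasoning
      x y : ℚ
      x = fromℕ k
      y = fromℕ (2 ^ k)

module FiniteSums where
  open import Data.Bool using (Bool; true; false; _∧_)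
  open import Data.Nat using (zero; suc; _+_; _*_)
  import Data.Nat.Properties as ℕ
  open import Data.Nat.Solver using (module +-*-Solver)
  open import Data.List using ([]; _∷_; _++_; map; concatMap; length; filterᵇ)
  open import Data.Vec using (Vec; []; _∷_; zipWith)
  open import Data.Product using (_,_)
  open import Relation.Nullary using (¬_; yes; no; contradiction)
  open import Relation.Binary.PropositionalEquality

  private
    variable
      A B : Set

  boolToℕ : Bool → ℕ
  boolToℕ true = 1
  boolToℕ false = 0

  boolToℕ-∧ : ∀ a b → boolToℕ (a ∧ b) ≡ boolToℕ a * boolToℕ b
  boolToℕ-∧ true b = sym (ℕ.+-identityʳ (boolToℕ b))
  boolToℕ-∧ false b = refl

  sumBy : (A → ℕ) → List A → ℕ
  sumBy f [] = 0
  sumBy f (x ∷ xs) = f x + sumBy f xs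

  sumBy-cong : ∀ {f g : A → ℕ} → (∀ x → f x ≡ g x) → ∀ xs → sumBy f xs ≡ sumBy g xs
  sumBy-cong f≗g [] = refl
  sumBy-cong f≗g (x ∷ xs) = cong₂ _+_ (f≗g x) (sumBy-cong f≗g xs)

  sumBy-++ : ∀ (f : A → ℕ) xs ys → sumBy f (xs ++ ys) ≡ sumBy f xs + sumBy f ys
  sumBy-++ f [] ys = refl
  sumBy-++ f (x ∷ xs) ys = trans (cong (f x +_) (sumBy-++ f xs ys)) (sym (ℕ.+-assoc (f x) _ _))

  sumBy-map : ∀ (f : B → ℕ) (g : A → B) xs → sumBy f (map g xs) ≡ sumBy (λ x → f (g x)) xs
  sumBy-map f g [] = refl
  sumBy-map f g (x ∷ xs) = cong (f (g x) +_) (sumBy-map f g xs)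

  sumBy-concatMap : ∀ (f : B → ℕ) (g : A → List B) xs →
    sumBy f (concatMap g xs) ≡ sumBy (λ x → sumBy f (g x)) xs
  sumBy-concatMap f g [] = refl
  sumBy-concatMap f g (x ∷ xs) =
    trans (sumBy-++ f (g x) (concatMap g xs)) (cong (sumBy f (g x) +_) (sumBy-concatMap f g xs))

  sumBy-+ : ∀ (f g : A → ℕ) xs → sumBy (λ x → f x + g x) xs ≡ sumBy f xs + sumBy g xs
  sumBy-+ f g [] = refl
  sumBy-+ f g (x ∷ xs) rewrite sumBy-+ f g xs =
    solve 4 (λ a b c d → (a :+ b) :+ (c :+ d) := (a :+ c) :+ (b :+ d)) refl (f x) (g x) (sumBy f xs) (sumBy g xs)
    where open +-*-Solver

  sumBy-*ˡ : ∀ c (f : A → ℕ) xs → sumBy (λ x → c * f x) xs ≡ c * sumBy f xs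
  sumBy-*ˡ c f [] = sym (ℕ.*-zeroʳ c)
  sumBy-*ˡ c f (x ∷ xs) =
    trans (cong (c * f x +_) (sumBy-*ˡ c f xs)) (sym (ℕ.*-distribˡ-+ c (f x) (sumBy f xs)))

  sumBy-0 : ∀ (xs : List A) → sumBy (λ _ → 0) xs ≡ 0
  sumBy-0 [] = refl
  sumBy-0 (x ∷ xs) = sumBy-0 xs

  sumBy-comm : ∀ (f : A → B → ℕ) xs ys →
    sumBy (λ x → sumBy (f x) ys) xs ≡ sumBy (λ y → sumBy (λ x → f x y) xs) ys
  sumBy-comm f [] ys = sym (sumBy-0 ys)
  sumBy-comm f (x ∷ xs) ys = trans (cong (sumBy (f x) ys +_) (sumBy-comm f xs ys))
    (sym (sumBy-+ (f x) (λ y → sumBy (λ x → f x y) xs) ys))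

  length-filterᵇ : ∀ (P : A → Bool) xs → length (filterᵇ P xs) ≡ sumBy (λ x → boolToℕ (P x)) xs
  length-filterᵇ P [] = refl
  length-filterᵇ P (x ∷ xs) with P x
  ... | true = cong suc (length-filterᵇ P xs)
  ... | false = length-filterᵇ P xs

  sumBy≢0⇒∃≢0 : ∀ (f : A → ℕ) xs → ¬ sumBy f xs ≡ 0 → ∃ λ x → ¬ f x ≡ 0
  sumBy≢0⇒∃≢0 f [] sum≢0 = contradiction refl sum≢0
  sumBy≢0⇒∃≢0 f (x ∷ xs) sum≢0 with f x ℕ.≟ 0
  ... | no fx≢0 = x , fx≢0
  ... | yes fx≡0 = sumBy≢0⇒∃≢0 f xs (λ sum≡0 → sum≢0 (trans (cong (_+ sumBy f xs) fx≡0) sum≡0))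

  sumBy-vecsOver-suc : ∀ {n} (w : Vec A (suc n) → ℕ) xs →
    sumBy w (vecsOver xs (suc n)) ≡ sumBy (λ x → sumBy (λ v → w (x ∷ v)) (vecsOver xs n)) xs
  sumBy-vecsOver-suc {n = n} w xs = trans (sumBy-concatMap w (λ x → map (x ∷_) (vecsOver xs n)) xs)
    (sumBy-cong (λ x → sumBy-map w (x ∷_) (vecsOver xs n)) xs)

  sumBy-vecsOver-columns : ∀ {k} (fs : List (Vec A k)) (bs : List A) n (w : Vec (Vec A (suc k)) n → ℕ) →
    sumBy w (vecsOver (concatMap (λ x → map (x ∷_) fs) bs) n)
      ≡ sumBy (λ b → sumBy (λ f → w (zipWith _∷_ b f)) (vecsOver fs n)) (vecsOver bs n)
  sumBy-vecsOver-columns fs bs zero w = sym (ℕ.+-identityʳ (w [] + 0))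
  sumBy-vecsOver-columns {A = A} {k = k} fs bs (suc n) w = begin
    sumBy w (vecsOver fbs (suc n))
      ≡⟨ sumBy-vecsOver-suc w fbs ⟩
    sumBy W fbs
      ≡⟨ sumBy-concatMap W (λ x → map (x ∷_) fs) bs ⟩
    sumBy (λ x → sumBy W (map (x ∷_) fs)) bs
      ≡⟨ sumBy-cong (λ x → sumBy-map W (x ∷_) fs) bs ⟩
    sumBy (λ x → sumBy (λ f₀ → W (x ∷ f₀)) fs) bs
      ≡⟨ sumBy-cong (λ x → sumBy-cong (λ f₀ → sumBy-vecsOver-columns fs bs n (λ v → w ((x ∷ f₀) ∷ v))) fs) bs ⟩
    sumBy (λ x → sumBy (λ f₀ → sumBy (λ b → sumBy (λ f → w′ x f₀ b f) (vecsOver fs n)) (vecsOver bs n)) fs) bs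
      ≡⟨ sumBy-cong (λ x → sumBy-comm _ fs (vecsOver bs n)) bs ⟩
    sumBy (λ x → sumBy (λ b → sumBy (λ f₀ → sumBy (λ f → w′ x f₀ b f) (vecsOver fs n)) fs) (vecsOver bs n)) bs
      ≡⟨ sumBy-cong (λ x → sumBy-cong (λ b → sumBy-vecsOver-suc (λ f → w (zipWith _∷_ (x ∷ b) f)) fs)
                                      (vecsOver bs n)) bs ⟨
    sumBy (λ x → sumBy (λ b → sumBy (λ f → w (zipWith _∷_ (x ∷ b) f)) (vecsOver fs (suc n))) (vecsOver bs n)) bs
      ≡⟨ sumBy-vecsOver-suc (λ b → sumBy (λ f → w (zipWith _∷_ b f)) (vecsOver fs (suc n))) bs ⟨
    sumBy (λ b → sumBy (λ f → w (zipWith _∷_ b f)) (vecsOver fs (suc n))) (vecsOver bs (suc n)) ∎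
    where
    open ≡-Reasoning
    fbs : List (Vec A (suc k))
    fbs = concatMap (λ x → map (x ∷_) fs) bs
    W : Vec A (suc k) → ℕ
    W y = sumBy (λ v → w (y ∷ v)) (vecsOver fbs n)
    w′ : A → Vec A k → Vec A n → Vec (Vec A k) n → ℕ
    w′ x f₀ b f = w ((x ∷ f₀) ∷ zipWith _∷_ b f)

module XorSubgroups where
  open FiniteSums
  open import Data.Bool using (Bool; true; false; _xor_)
  open import Data.Bool.Properties using (xor-same; xor-assoc; xor-identityʳ; ⇔→≡)
  open import Data.Nat using (zero; suc; _+_)
  import Data.Nat.Properties as ℕ
  open import Data.Nat.Solver using (module +-*-Solver)
  open import Data.List using (List; []; _∷_)
  open import Data.Vec using (Vec; []; _∷_; zipWith; replicate)
  open import Data.Product using (_,_)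
  open import Function.Bundles using (mk⇔)
  open import Relation.Nullary using (¬_; yes; no; contradiction)
  open import Relation.Binary.PropositionalEquality

  bools : List Bool
  bools = true ∷ false ∷ []

  infixl 6 _⊕_
  _⊕_ : ∀ {n} → Vec Bool n → Vec Bool n → Vec Bool n
  _⊕_ = zipWith _xor_

  ⊕-cancelʳ : ∀ {n} (v w : Vec Bool n) → v ⊕ w ⊕ w ≡ v
  ⊕-cancelʳ [] [] = refl
  ⊕-cancelʳ (x ∷ v) (c ∷ w) =
    cong₂ _∷_ (trans (xor-assoc x c c) (trans (cong (x xor_) (xor-same c)) (xor-identityʳ x))) (⊕-cancelʳ v w)

  sumBy-⊕-invariant : ∀ n (g : Vec Bool n → ℕ) w →
    sumBy (λ v → g (v ⊕ w)) (vecsOver bools n) ≡ sumBy g (vecsOver bools n)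
  sumBy-⊕-invariant zero g [] = refl
  sumBy-⊕-invariant (suc n) g (c ∷ w) = begin
    sumBy (λ v → g (v ⊕ (c ∷ w))) (vecsOver bools (suc n))
      ≡⟨ sumBy-vecsOver-suc (λ v → g (v ⊕ (c ∷ w))) bools ⟩
    sumBy (λ x → sumBy (λ v → g ((x xor c) ∷ v ⊕ w)) (vecsOver bools n)) bools
      ≡⟨ sumBy-cong (λ x → sumBy-⊕-invariant n (λ v → g ((x xor c) ∷ v)) w) bools ⟩
    sumBy (λ x → G (x xor c)) bools
      ≡⟨ sumBy-xor c ⟩
    sumBy G bools
      ≡⟨ sumBy-vecsOver-suc g bools ⟨
    sumBy g (vecsOver bools (suc n)) ∎
    where
    open ≡-Reasoning
    G : Bool → ℕ
    G x = sumBy (λ v → g (x ∷ v)) (vecsOver bools n)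
    sumBy-xor : ∀ c → sumBy (λ x → G (x xor c)) bools ≡ sumBy G bools
    sumBy-xor false = refl
    sumBy-xor true = solve 2 (λ a b → a :+ (b :+ con 0) := b :+ (a :+ con 0)) refl (G false) (G true)
      where open +-*-Solver

  record IsXorSubgroup {n} (K : Vec Bool n → Bool) : Set where
    field
      zero∈ : K (replicate n false) ≡ true
      ⊕-closed : ∀ {u v} → K u ≡ true → K v ≡ true → K (u ⊕ v) ≡ true

  IsXorSubgroup-false∷ : ∀ {n} {K : Vec Bool (suc n) → Bool} →
    IsXorSubgroup K → IsXorSubgroup (λ v → K (false ∷ v))
  IsXorSubgroup-false∷ K-sub = record { zero∈ = zero∈ ; ⊕-closed = ⊕-closed }
    where open IsXorSubgroup K-sub

  xorSubgroup-cosets : ∀ {n} {K : Vec Bool (suc n) → Bool} → IsXorSubgroup K → ∀ {w} → K (true ∷ w) ≡ true →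
    sumBy (λ v → boolToℕ (K (true ∷ v))) (vecsOver bools n)
      ≡ sumBy (λ v → boolToℕ (K (false ∷ v))) (vecsOver bools n)
  xorSubgroup-cosets {n} {K} K-sub {w} w∈ = begin
    sumBy (λ v → boolToℕ (K (true ∷ v))) (vecsOver bools n)
      ≡⟨ sumBy-cong (λ v → cong boolToℕ (translate v)) (vecsOver bools n) ⟩
    sumBy (λ v → boolToℕ (K (false ∷ v ⊕ w))) (vecsOver bools n)
      ≡⟨ sumBy-⊕-invariant n (λ v → boolToℕ (K (false ∷ v))) w ⟩
    sumBy (λ v → boolToℕ (K (false ∷ v))) (vecsOver bools n) ∎
    where
    open ≡-Reasoning
    open IsXorSubgroup K-sub
    translate : ∀ v → K (true ∷ v) ≡ K (false ∷ v ⊕ w)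
    translate v = ⇔→≡ (mk⇔ (λ v∈ → ⊕-closed v∈ w∈)
                           (λ v⊕w∈ → subst (λ u → K (true ∷ u) ≡ true) (⊕-cancelʳ v w) (⊕-closed v⊕w∈ w∈)))

  boolToℕ≢0⇒≡true : ∀ {b} → ¬ boolToℕ b ≡ 0 → b ≡ true
  boolToℕ≢0⇒≡true {true} _ = refl
  boolToℕ≢0⇒≡true {false} b≢0 = contradiction refl b≢0

  xorSubgroup-size≡2^ : ∀ n {K : Vec Bool n → Bool} → IsXorSubgroup K →
    ∃ λ c → sumBy (λ v → boolToℕ (K v)) (vecsOver bools n) ≡ 2 ^ c
  xorSubgroup-size≡2^ zero K-sub = 0 , cong (λ b → boolToℕ b + 0) (IsXorSubgroup.zero∈ K-sub)
  xorSubgroup-size≡2^ (suc n) {K} K-sub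
    with xorSubgroup-size≡2^ n (IsXorSubgroup-false∷ K-sub) | S₁ ℕ.≟ 0
    where
    S₁ : ℕ
    S₁ = sumBy (λ v → boolToℕ (K (true ∷ v))) (vecsOver bools n)
  ... | c , S₀≡2^c | yes S₁≡0 = c , trans (sumBy-vecsOver-suc (λ v → boolToℕ (K v)) bools)
          (cong₂ _+_ S₁≡0 (trans (ℕ.+-identityʳ _) S₀≡2^c))
  ... | c , S₀≡2^c | no S₁≢0
    with sumBy≢0⇒∃≢0 (λ v → boolToℕ (K (true ∷ v))) (vecsOver bools n) S₁≢0
  ... | w , Kw≢0 = suc c , trans (sumBy-vecsOver-suc (λ v → boolToℕ (K v)) bools)
          (cong₂ _+_ (trans (xorSubgroup-cosets K-sub (boolToℕ≢0⇒≡true Kw≢0)) S₀≡2^c) (cong (_+ 0) S₀≡2^c))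

module PointwiseLists where
  open import Algebra.Bundles using (CommutativeMonoid)
  open import Data.Bool using (Bool; true; false; _∧_; T)
  open import Data.Bool.Properties using (∧-commutativeMonoid)
  open import Algebra.Properties.CommutativeSemigroup (CommutativeMonoid.commutativeSemigroup ∧-commutativeMonoid)
    using () renaming (interchange to ∧-interchange)
  open import Data.Nat using (zero; suc; _+_; _∸_; _<_; _≡ᵇ_; _≤ᵇ_; z<s)
  import Data.Nat.Properties as ℕ
  open import Data.Nat.Solver using (module +-*-Solver)
  open import Data.Nat.ListAction using (sum)
  open import Data.List using ([]; _∷_; map; length)
  open import Data.Product using (_,_)
  open import Data.Unit using (tt)
  open import Relation.Binary.PropositionalEquality

  ∧≡true : ∀ {a b} → a ∧ b ≡ true → a ≡ true × b ≡ true
  ∧≡true {true} {true} refl = refl , refl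

  +-≡ᵇ : ∀ a y c → (a + y ≡ᵇ c) ≡ (a ≤ᵇ c) ∧ (y ≡ᵇ c ∸ a)
  +-≡ᵇ zero y c = refl
  +-≡ᵇ (suc a) y zero = refl
  +-≡ᵇ (suc a) y (suc c) = trans (+-≡ᵇ a y c) (cong (_∧ (y ≡ᵇ c ∸ a)) (≤ᵇ-suc a c))
    where
    ≤ᵇ-suc : ∀ a c → (a ≤ᵇ c) ≡ (suc a ≤ᵇ suc c)
    ≤ᵇ-suc zero c = refl
    ≤ᵇ-suc (suc a) c = refl

  infix 4 _≡ᵇ*_ _≤ᵇ*_
  infixl 6 _∸*_

  _≡ᵇ*_ : List ℕ → List ℕ → Bool
  [] ≡ᵇ* [] = true
  [] ≡ᵇ* (_ ∷ _) = false
  (_ ∷ _) ≡ᵇ* [] = false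
  (a ∷ d) ≡ᵇ* (c ∷ t) = (a ≡ᵇ c) ∧ (d ≡ᵇ* t)

  -- d ≤ᵇ* t and t ∸* d only look at the first length d entries of t; they are used only on
  -- lists of equal length.
  _≤ᵇ*_ : List ℕ → List ℕ → Bool
  [] ≤ᵇ* t = true
  (_ ∷ _) ≤ᵇ* [] = false
  (a ∷ d) ≤ᵇ* (c ∷ t) = (a ≤ᵇ c) ∧ (d ≤ᵇ* t)

  _∸*_ : List ℕ → List ℕ → List ℕ
  t ∸* [] = t
  [] ∸* (_ ∷ _) = []
  (c ∷ t) ∸* (a ∷ d) = (c ∸ a) ∷ (t ∸* d)

  allZeroᵇ : List ℕ → Bool
  allZeroᵇ [] = true
  allZeroᵇ (a ∷ d) = (a ≡ᵇ 0) ∧ allZeroᵇ d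

  length-∸* : ∀ t d → length (t ∸* d) ≡ length t
  length-∸* t [] = refl
  length-∸* [] (a ∷ d) = refl
  length-∸* (c ∷ t) (a ∷ d) = cong suc (length-∸* t d)

  map-+-≡ᵇ* : ∀ {E : Set} (g h : E → ℕ) es t →
    (map (λ e → g e + h e) es ≡ᵇ* t) ≡ (map g es ≤ᵇ* t) ∧ (map h es ≡ᵇ* t ∸* map g es)
  map-+-≡ᵇ* g h [] [] = refl
  map-+-≡ᵇ* g h [] (c ∷ t) = refl
  map-+-≡ᵇ* g h (e ∷ es) [] = refl
  map-+-≡ᵇ* g h (e ∷ es) (c ∷ t) = begin
    (g e + h e ≡ᵇ c) ∧ (map (λ e → g e + h e) es ≡ᵇ* t)
      ≡⟨ cong₂ _∧_ (+-≡ᵇ (g e) (h e) c) (map-+-≡ᵇ* g h es t) ⟩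
    ((g e ≤ᵇ c) ∧ (h e ≡ᵇ c ∸ g e)) ∧ ((map g es ≤ᵇ* t) ∧ (map h es ≡ᵇ* t ∸* map g es))
      ≡⟨ ∧-interchange (g e ≤ᵇ c) _ _ _ ⟩
    ((g e ≤ᵇ c) ∧ (map g es ≤ᵇ* t)) ∧ ((h e ≡ᵇ c ∸ g e) ∧ (map h es ≡ᵇ* t ∸* map g es)) ∎
    where open ≡-Reasoning

  allZeroᵇ⇒≤ᵇ* : ∀ d t → allZeroᵇ d ≡ true → length d ≡ length t → (d ≤ᵇ* t) ≡ true
  allZeroᵇ⇒≤ᵇ* [] t _ _ = refl
  allZeroᵇ⇒≤ᵇ* (zero ∷ d) (c ∷ t) d≡0 |d|≡|t| = allZeroᵇ⇒≤ᵇ* d t d≡0 (ℕ.suc-injective |d|≡|t|)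

  allZeroᵇ⇒∸*-identityʳ : ∀ d t → allZeroᵇ d ≡ true → t ∸* d ≡ t
  allZeroᵇ⇒∸*-identityʳ [] t _ = refl
  allZeroᵇ⇒∸*-identityʳ (zero ∷ d) [] _ = refl
  allZeroᵇ⇒∸*-identityʳ (zero ∷ d) (c ∷ t) d≡0 = cong (c ∷_) (allZeroᵇ⇒∸*-identityʳ d t d≡0)

  sum-∸*-+ : ∀ d t → (d ≤ᵇ* t) ≡ true → sum (t ∸* d) + sum d ≡ sum t
  sum-∸*-+ [] t _ = ℕ.+-identityʳ (sum t)
  sum-∸*-+ (a ∷ d) (c ∷ t) ≤ with ∧≡true {a ≤ᵇ c} ≤
  ... | a≤c , d≤t = begin
    (c ∸ a + sum (t ∸* d)) + (a + sum d)
      ≡⟨ solve 4 (λ x y z w → (x :+ y) :+ (z :+ w) := (x :+ z) :+ (y :+ w)) refl (c ∸ a) (sum (t ∸* d)) a (sum d) ⟩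
    (c ∸ a + a) + (sum (t ∸* d) + sum d)
      ≡⟨ cong₂ _+_ (ℕ.m∸n+n≡m (ℕ.≤ᵇ⇒≤ a c (subst T (sym a≤c) tt))) (sum-∸*-+ d t d≤t) ⟩
    c + sum t ∎
    where
    open ≡-Reasoning
    open +-*-Solver

  ≢allZeroᵇ⇒sum-∸*< : ∀ d t → allZeroᵇ d ≡ false → (d ≤ᵇ* t) ≡ true → sum (t ∸* d) < sum t
  ≢allZeroᵇ⇒sum-∸*< d t d≢0 d≤t =
    subst (sum (t ∸* d) <_) (sum-∸*-+ d t d≤t) (ℕ.m<m+n (sum (t ∸* d)) (0<sum d d≢0))
    where
    0<sum : ∀ d → allZeroᵇ d ≡ false → 0 < sum d
    0<sum (zero ∷ d) d≢0 = 0<sum d d≢0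
    0<sum (suc a ∷ d) _ = z<s

module EdgeProfiles (n : ℕ) (es : List (Fin n × Fin n)) where
  open FiniteSums
  open XorSubgroups
  open PointwiseLists
  open import Data.Bool using (Bool; true; false; not; _∧_; _xor_)
  open import Data.Bool.Properties using (xor-same)
  open import Data.Nat using (suc; _+_; _*_; _≡ᵇ_)
  import Data.Nat.Properties as ℕ
  open import Data.List using ([]; _∷_; map; length)
  import Data.List.Properties as List
  open import Data.Vec using (Vec; _∷_; zipWith; lookup; replicate)
  import Data.Vec.Properties as Vec
  open import Data.Product using (_,_)
  open import Relation.Binary.PropositionalEquality

  hamming-∷ : ∀ {k} x y (xs ys : Vec Bool k) → hamming (x ∷ xs) (y ∷ ys) ≡ boolToℕ (x xor y) + hamming xs ys
  hamming-∷ true true xs ys = refl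
  hamming-∷ true false xs ys = refl
  hamming-∷ false true xs ys = refl
  hamming-∷ false false xs ys = refl

  distance : ∀ {k} → Vec (Vec Bool k) n → Fin n × Fin n → ℕ
  distance f (u , v) = hamming (lookup f u) (lookup f v)

  crossing : Vec Bool n → Fin n × Fin n → ℕ
  crossing b (u , v) = boolToℕ (lookup b u xor lookup b v)

  cut : Vec Bool n → List ℕ
  cut b = map (crossing b) es

  profileCount : ℕ → List ℕ → ℕ
  profileCount k t = sumBy (λ f → boolToℕ (map (distance f) es ≡ᵇ* t)) (vecsOver (vertsQ k) n)

  distance-∷ : ∀ {k} b (f : Vec (Vec Bool k) n) e → distance (zipWith _∷_ b f) e ≡ crossing b e + distance f e
  distance-∷ b f (u , v) = trans (cong₂ hamming (Vec.lookup-zipWith _∷_ u b f) (Vec.lookup-zipWith _∷_ v b f))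
    (hamming-∷ (lookup b u) (lookup b v) (lookup f u) (lookup f v))

  -- vertsQ (suc k) is by definition concatMap (λ x → map (x ∷_) (vertsQ k)) bools, so the first
  -- step splits off the first coordinate b of every vertex image.
  profileCount-suc : ∀ k t →
    profileCount (suc k) t ≡ sumBy (λ b → boolToℕ (cut b ≤ᵇ* t) * profileCount k (t ∸* cut b)) (vecsOver bools n)
  profileCount-suc k t = begin
    profileCount (suc k) t
      ≡⟨ sumBy-vecsOver-columns (vertsQ k) bools n _ ⟩
    sumBy (λ b → sumBy (λ f → boolToℕ (map (distance (zipWith _∷_ b f)) es ≡ᵇ* t)) Fs) (vecsOver bools n)
      ≡⟨ sumBy-cong (λ b → sumBy-cong (λ f → cong boolToℕ (split b f)) Fs) (vecsOver bools n) ⟩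
    sumBy (λ b → sumBy (λ f → boolToℕ ((cut b ≤ᵇ* t) ∧ (map (distance f) es ≡ᵇ* t ∸* cut b))) Fs) (vecsOver bools n)
      ≡⟨ sumBy-cong (λ b → trans (sumBy-cong (λ f → boolToℕ-∧ (cut b ≤ᵇ* t) _) Fs)
                                 (sumBy-*ˡ (boolToℕ (cut b ≤ᵇ* t)) _ Fs)) (vecsOver bools n) ⟩
    sumBy (λ b → boolToℕ (cut b ≤ᵇ* t) * profileCount k (t ∸* cut b)) (vecsOver bools n) ∎
    where
    open ≡-Reasoning
    Fs : List (Vec (Vec Bool k) n)
    Fs = vecsOver (vertsQ k) n
    split : ∀ b (f : Vec (Vec Bool k) n) →
      (map (distance (zipWith _∷_ b f)) es ≡ᵇ* t) ≡ (cut b ≤ᵇ* t) ∧ (map (distance f) es ≡ᵇ* t ∸* cut b)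
    split b f = trans (cong (_≡ᵇ* t) (List.map-cong (distance-∷ b f) es)) (map-+-≡ᵇ* (crossing b) (distance f) es t)

  uncut : Vec Bool n → Bool
  uncut b = allZeroᵇ (cut b)

  uncut-isXorSubgroup : IsXorSubgroup uncut
  uncut-isXorSubgroup = record
    { zero∈ = uncut-zero es
    ; ⊕-closed = λ {b} {b′} → uncut-⊕ b b′ es
    }
    where
    xor-≡ᵇ0 : ∀ x y → (boolToℕ (x xor y) ≡ᵇ 0) ≡ true → x ≡ y
    xor-≡ᵇ0 true true _ = refl
    xor-≡ᵇ0 false false _ = refl

    uncut-zero : ∀ es′ → allZeroᵇ (map (crossing (replicate n false)) es′) ≡ true
    uncut-zero [] = refl
    uncut-zero ((u , v) ∷ es′) rewrite Vec.lookup-replicate u false | Vec.lookup-replicate v false = uncut-zero es′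

    uncut-⊕ : ∀ b b′ es′ → allZeroᵇ (map (crossing b) es′) ≡ true →
      allZeroᵇ (map (crossing b′) es′) ≡ true → allZeroᵇ (map (crossing (b ⊕ b′)) es′) ≡ true
    uncut-⊕ b b′ [] _ _ = refl
    uncut-⊕ b b′ ((u , v) ∷ es′) b-uncut b′-uncut with ∧≡true b-uncut | ∧≡true b′-uncut
    ... | bu≡bv , b-rest | b′u≡b′v , b′-rest
      rewrite Vec.lookup-zipWith _xor_ u b b′ | Vec.lookup-zipWith _xor_ v b b′
            | xor-≡ᵇ0 (lookup b u) (lookup b v) bu≡bv | xor-≡ᵇ0 (lookup b′ u) (lookup b′ v) b′u≡b′v
            | xor-same (lookup b v xor lookup b′ v) = uncut-⊕ b b′ es′ b-rest b′-rest

  uncutCount : ℕ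
  uncutCount = sumBy (λ b → boolToℕ (uncut b)) (vecsOver bools n)

  uncutCount≡2^ : ∃ λ c → uncutCount ≡ 2 ^ c
  uncutCount≡2^ = xorSubgroup-size≡2^ n uncut-isXorSubgroup

  cutTerm : ℕ → List ℕ → Vec Bool n → ℕ
  cutTerm k t b = boolToℕ (not (uncut b)) * (boolToℕ (cut b ≤ᵇ* t) * profileCount k (t ∸* cut b))

  cutTerms : ℕ → List ℕ → ℕ
  cutTerms k t = sumBy (cutTerm k t) (vecsOver bools n)

  profileCount-recurrence : ∀ k t → length t ≡ length es →
    profileCount (suc k) t ≡ uncutCount * profileCount k t + cutTerms k t
  profileCount-recurrence k t |t|≡|es| = begin
    profileCount (suc k) t
      ≡⟨ profileCount-suc k t ⟩
    sumBy (λ b → boolToℕ (cut b ≤ᵇ* t) * profileCount k (t ∸* cut b)) (vecsOver bools n)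
      ≡⟨ sumBy-cong split (vecsOver bools n) ⟩
    sumBy (λ b → boolToℕ (uncut b) * profileCount k t + cutTerm k t b) (vecsOver bools n)
      ≡⟨ sumBy-+ (λ b → boolToℕ (uncut b) * profileCount k t) (cutTerm k t) (vecsOver bools n) ⟩
    sumBy (λ b → boolToℕ (uncut b) * profileCount k t) (vecsOver bools n) + cutTerms k t
      ≡⟨ cong (_+ cutTerms k t)
              (sumBy-cong (λ b → ℕ.*-comm (boolToℕ (uncut b)) (profileCount k t)) (vecsOver bools n)) ⟩
    sumBy (λ b → profileCount k t * boolToℕ (uncut b)) (vecsOver bools n) + cutTerms k t
      ≡⟨ cong (_+ cutTerms k t) (sumBy-*ˡ (profileCount k t) (λ b → boolToℕ (uncut b)) (vecsOver bools n)) ⟩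
    profileCount k t * uncutCount + cutTerms k t
      ≡⟨ cong (_+ cutTerms k t) (ℕ.*-comm (profileCount k t) uncutCount) ⟩
    uncutCount * profileCount k t + cutTerms k t ∎
    where
    open ≡-Reasoning
    split : ∀ b → boolToℕ (cut b ≤ᵇ* t) * profileCount k (t ∸* cut b)
                ≡ boolToℕ (uncut b) * profileCount k t + cutTerm k t b
    split b with uncut b in b-uncut
    ... | false = sym (ℕ.*-identityˡ _)
    ... | true rewrite allZeroᵇ⇒≤ᵇ* (cut b) t b-uncut (trans (List.length-map (crossing b) es) (sym |t|≡|es|))
                     | allZeroᵇ⇒∸*-identityʳ (cut b) t b-uncut = sym (ℕ.+-identityʳ _)

open NatEmbedding
open ExponentialPolynomials
open BivariatePolynomials
open FiniteSums
open XorSubgroups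
open PointwiseLists
open import Data.Bool using (Bool; true; false; _∧_)
open import Data.Nat using (suc; _<_)
import Data.Nat as ℕ
import Data.Nat.Properties as ℕ
open import Data.Nat.Induction using (<-wellFounded)
open import Data.Nat.ListAction using (sum)
open import Data.List using ([]; _∷_; map; length)
import Data.List.Properties as List
open import Data.Product using (_,_)
open import Data.Rational using (ℚ; _+_; _*_)
open import Induction.WellFounded using (WellFounded; module All)
open import Relation.Binary.Construct.On using () renaming (wellFounded to on-wellFounded)
open import Relation.Binary.PropositionalEquality

ExpPolynomial-sumBy : ∀ {a} {B : Set} (F : ℕ → B → ℕ) xs → (∀ x → ExpPolynomial a (λ k → fromℕ (F k x))) →
  ExpPolynomial a (λ k → fromℕ (sumBy (F k) xs))
ExpPolynomial-sumBy {a} F [] _ = ExpPolynomial-cong (λ _ → sym fromℕ-0) (ExpPolynomial-0 a)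
ExpPolynomial-sumBy F (x ∷ xs) F-exp = ExpPolynomial-cong (λ k → sym (fromℕ-+ (F k x) (sumBy (F k) xs)))
  (ExpPolynomial-+ (F-exp x) (ExpPolynomial-sumBy F xs F-exp))

sum-wellFounded : WellFounded (λ s t → sum s < sum t)
sum-wellFounded = on-wellFounded sum <-wellFounded

allB-≡ᵇ* : ∀ {V : Set} (p : V × V → Bool) (d c : V × V → ℕ) →
  (∀ u v → p (u , v) ≡ (d (u , v) ℕ.≡ᵇ c (u , v))) → ∀ es → allB p es ≡ (map d es ≡ᵇ* map c es)
allB-≡ᵇ* p d c p≗ [] = refl
allB-≡ᵇ* p d c p≗ ((u , v) ∷ es) = cong₂ _∧_ (p≗ u v) (allB-≡ᵇ* p d c p≗ es)

module _ (G : Graph) where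
  open EdgeProfiles (n G) (edges G)

  profileCount-ExpPolynomial : ∀ c → uncutCount ≡ 2 ^ c →
    ∀ t → length t ≡ length (edges G) → ExpPolynomial (fromℕ (2 ^ c)) (λ k → fromℕ (profileCount k t))
  profileCount-ExpPolynomial c uncutCount≡2^c = All.wfRec sum-wellFounded _ P step
    where
    a : ℚ
    a = fromℕ (2 ^ c)

    P : List ℕ → Set
    P t = length t ≡ length (edges G) → ExpPolynomial a (λ k → fromℕ (profileCount k t))

    step : ∀ t → (∀ {s} → sum s < sum t → P s) → P t
    step t IH |t|≡|E| = ExpPolynomial-recurrence (fromℕ-invertible (2 ^ c) {{ℕ.m^n≢0 2 c}}) cutTerms-exp λ k → begin
      fromℕ (profileCount (suc k) t)
        ≡⟨ cong fromℕ (profileCount-recurrence k t |t|≡|E|) ⟩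
      fromℕ (uncutCount ℕ.* profileCount k t ℕ.+ cutTerms k t)
        ≡⟨ cong (λ A → fromℕ (A ℕ.* profileCount k t ℕ.+ cutTerms k t)) uncutCount≡2^c ⟩
      fromℕ (2 ^ c ℕ.* profileCount k t ℕ.+ cutTerms k t)
        ≡⟨ fromℕ-+ (2 ^ c ℕ.* profileCount k t) (cutTerms k t) ⟩
      fromℕ (2 ^ c ℕ.* profileCount k t) + fromℕ (cutTerms k t)
        ≡⟨ cong (_+ fromℕ (cutTerms k t)) (fromℕ-* (2 ^ c) (profileCount k t)) ⟩
      a * fromℕ (profileCount k t) + fromℕ (cutTerms k t) ∎
      where
      open ≡-Reasoning
      cutTerm-exp : ∀ b → ExpPolynomial a (λ k → fromℕ (cutTerm k t b))
      cutTerm-exp b with uncut b in b-uncut | cut b ≤ᵇ* t in b≤t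
      ... | true  | _     = ExpPolynomial-cong (λ _ → sym fromℕ-0) (ExpPolynomial-0 a)
      ... | false | false = ExpPolynomial-cong (λ _ → sym fromℕ-0) (ExpPolynomial-0 a)
      ... | false | true  = ExpPolynomial-cong (λ k → cong fromℕ (sym (trans (ℕ.*-identityˡ _) (ℕ.*-identityˡ _))))
        (IH (≢allZeroᵇ⇒sum-∸*< (cut b) t b-uncut b≤t) (trans (length-∸* t (cut b)) |t|≡|E|))
      cutTerms-exp : ExpPolynomial a (λ k → fromℕ (cutTerms k t))
      cutTerms-exp = ExpPolynomial-sumBy (λ k → cutTerm k t) (vecsOver bools (n G)) cutTerm-exp

  ones : List ℕ
  ones = map (λ _ → 1) (edges G)

  homQ≡profileCount : ∀ k → homQ G k ≡ profileCount k ones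
  homQ≡profileCount k = trans (length-filterᵇ (isHom G) (vecsOver (vertsQ k) (n G)))
    (sumBy-cong isHom≡ (vecsOver (vertsQ k) (n G)))
    where
    isHom≡ : ∀ f → boolToℕ (isHom G f) ≡ boolToℕ (map (distance f) (edges G) ≡ᵇ* ones)
    isHom≡ f = cong boolToℕ (allB-≡ᵇ* _ (distance f) (λ _ → 1) (λ _ _ → refl) (edges G))

  homQ-ExpPolynomial : ∃ λ c → ExpPolynomial (fromℕ (2 ^ c)) (λ k → toℚ (homQ G k))
  homQ-ExpPolynomial with uncutCount≡2^
  ... | c , uncutCount≡2^c = c , ExpPolynomial-cong profileCount≡homQ
    (profileCount-ExpPolynomial c uncutCount≡2^c ones (List.length-map _ (edges G)))
    where
    profileCount≡homQ : ∀ k → fromℕ (profileCount k ones) ≡ toℚ (homQ G k)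
    profileCount≡homQ k = trans (cong fromℕ (sym (homQ≡profileCount k))) (fromℕ≡toℚ (homQ G k))

proposition3p8 : (G : Graph) → ∃ λ (p : Poly₂) →
    (k : ℕ) → toℚ (homQ G k) ≡ eval₂ p (toℚ k) (toℚ (2 ^ k))
proposition3p8 G with homQ-ExpPolynomial G
... | c , homQ-exp = ExpPolynomial-2^⇒Poly₂ {c} homQ-exp
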